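{- There exists a positive integer $N$ such that, for every positive integer $n$ all of whose prime factors are greater than $N$, and every subset $A\subseteq\mathbb{Z}_n\setminus\{0\}$ with $|A|=k\leq 12$, there exists an ordering $(a_1,\dots,a_k)$ of the elements of $A$ such that the partial sums $s_i=a_1+\dots+a_i$, $1\le i\le k$, are pairwise distinct. -}

module Defs where

open import Data.Nat using (ℕ; zero; suc; NonZero; _<_)
open import Data.Nat.DivMod using (_mod_)
open import Data.Fin using (Fin; toℕ)
open import Data.List using (List; []; _∷_)
open import Data.Nat.Primality using (Prime)
open import Data.Nat.Divisibility using (_∣_)

_+ₙ_ : ∀ {n} .{{_ : NonZero n}} → Fin n → Fin n → Fin n
_+ₙ_ {n} a b = (toℕ a Data.Nat.+ toℕ b) mod n

partialSumsFrom : ∀ {n} .{{_ : NonZero n}} → Fin n → List (Fin n) → List (Fin n)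
partialSumsFrom s []       = []
partialSumsFrom s (a ∷ as) = let s' = s +ₙ a in s' ∷ partialSumsFrom s' as

partialSums : ∀ {n} .{{_ : NonZero n}} → List (Fin n) → List (Fin n)
partialSums {n} = partialSumsFrom (0 mod n)

AllPrimeFactorsAbove : ℕ → ℕ → Set
AllPrimeFactorsAbove N n = ∀ p → Prime p → p ∣ n → N < p

module Submission where

-- Pigeonholing the leading base-D digits (D = 2k + 1) of the residues of s·a mod n over
-- s = 0, …, D^k gives 0 < t ≤ D^k and integers w(a) ≡ t·a (mod n) with D·|w(a)| < n for all
-- a ∈ A.  Since every prime factor of n exceeds D^k ≥ t, multiplication by t is injective
-- on ℤ_n, so the w(a) are distinct and nonzero.  Distinct nonzero integers can always be
-- ordered with distinct partial sums; these have absolute value at most k·n/D < n/2, so they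
-- stay distinct modulo n, where they are t times the partial sums of the same ordering of A.

open import Defs
open import Data.Nat as ℕ using (ℕ; zero; suc; NonZero; _∸_; _^_)
import Data.Nat.Properties as ℕ
open import Data.Nat.Coprimality using (Coprime)
open import Data.Nat.DivMod
  using (_mod_; _%_; _/_; m<n⇒m%n≡m; m%n<n; m≡m%n+[m/n]*n; m<n*o⇒m/o<n)
open import Data.Nat.Divisibility using (_∣_; ∣-trans; m∣m*n; ∣⇒≤; 0∣⇒≡0)
open import Data.Nat.ListAction using (product)
open import Data.Nat.Primality.Factorisation using (factorise; PrimeFactorisation)
open import Data.Nat.Tactic.RingSolver using () renaming (solve-∀ to ℕ-solve-∀)
open import Data.Integer using (ℤ; +_; 0ℤ; _+_; -_; _-_; _*_; _⊖_; ∣_∣)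
import Data.Integer.Properties as ℤP
open import Data.Integer.Tactic.RingSolver using (solve-∀)
open import Data.Fin using (Fin; zero; toℕ; fromℕ<; combine)
open import Data.Fin.Properties
  using (toℕ-fromℕ<; toℕ<n; toℕ-injective; combine-injective; pigeonhole)
open import Data.List using (List; []; _∷_; _++_; [_]; foldr; length; map)
open import Data.List.Membership.Propositional using (_∈_; find)
open import Data.List.Membership.Propositional.Properties using (∈-∃++)
open import Data.List.Relation.Unary.All as All using (All; []; _∷_)
open import Data.List.Relation.Unary.All.Properties using (¬Any⇒All¬)
  renaming (++⁺ to All-++⁺; map⁺ to All-map⁺)
open import Data.List.Relation.Unary.AllPairs using ([]; _∷_)
import Data.List.Relation.Unary.AllPairs.Properties as AllPairs
open import Data.List.Relation.Unary.Any using (any?; here; there)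
open import Data.List.Relation.Unary.Unique.Propositional using (Unique)
open import Data.List.Relation.Unary.Unique.Propositional.Properties using ()
  renaming (map⁺ to Unique-map⁺)
open import Data.List.Relation.Binary.Pointwise using (Pointwise; []; _∷_)
open import Data.List.Relation.Binary.Permutation.Propositional
  using (_↭_; ↭-refl; ↭-sym; ↭-trans; prep; ↭⇒↭ₛ)
open import Data.List.Relation.Binary.Permutation.Propositional.Properties
  using (shift; ∷↭∷ʳ; ↭-length; ∈-resp-↭; All-resp-↭; ↭-map-inv)
open import Data.Product using (Σ; ∃; ∃₂; _×_; _,_)
open import Data.Sum using (_⊎_; inj₁; inj₂)
open import Data.Empty using (⊥-elim)
open import Function using (_∘_)
open import Relation.Nullary using (¬_; yes; no; _×-dec_)
open import Relation.Unary using (Decidable)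
open import Relation.Binary.Definitions using (tri<; tri≈; tri>)
open import Relation.Binary.PropositionalEquality
  using (_≡_; _≢_; ≢-sym; refl; sym; trans; cong; cong₂; subst; subst₂; setoid; module ≡-Reasoning)

select : ∀ {A : Set} {P : A → Set} → Decidable P → ∀ xs →
         All (¬_ ∘ P) xs ⊎ ∃₂ λ x rest → P x × xs ↭ x ∷ rest
select P? xs with any? P? xs
... | no ¬any = inj₁ (¬Any⇒All¬ xs ¬any)
... | yes any with x , x∈xs , px ← find any with ys , zs , refl ← ∈-∃++ x∈xs =
  inj₂ (x , ys ++ zs , px , shift x ys zs)

module IntegerSequencing where

  open import Data.Integer using (_<_; _≤_; _<?_; _≤?_)
  open import Data.Integer.Properties
    using ( +-identityˡ; +-identityʳ; +-assoc; +-inverseˡ; +-0-isCommutativeMonoid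
          ; +-mono-<; +-monoˡ-<; +-monoʳ-<; +-monoʳ-≤; ≤-reflexive; ≤-trans; <-trans
          ; ≤-<-trans; <-≤-trans; <⇒≤; <⇒≢; <⇒≱; <-asym; <-cmp; ≤∧≢⇒<; ≮⇒≥; ≰⇒>)
  import Data.List.Relation.Binary.Permutation.Setoid.Properties (setoid ℤ) as Permutation

  sum : List ℤ → ℤ
  sum = foldr _+_ 0ℤ

  sumsFrom : ℤ → List ℤ → List ℤ
  sumsFrom c []       = []
  sumsFrom c (x ∷ xs) = c + x ∷ sumsFrom (c + x) xs

  sum-↭ : ∀ {xs ys} → xs ↭ ys → sum xs ≡ sum ys
  sum-↭ p = Permutation.foldr-commMonoid +-0-isCommutativeMonoid (↭⇒↭ₛ p)

  sumsFrom-∷ʳ : ∀ c xs z → sumsFrom c (xs ++ [ z ]) ≡ sumsFrom c xs ++ [ c + sum xs + z ]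
  sumsFrom-∷ʳ c []       z = cong (λ s → s + z ∷ []) (sym (+-identityʳ c))
  sumsFrom-∷ʳ c (x ∷ xs) z =
    cong (c + x ∷_) (trans (sumsFrom-∷ʳ (c + x) xs z)
                           (cong (λ s → sumsFrom (c + x) xs ++ [ s + z ]) (+-assoc c x (sum xs))))

  sum-negative : ∀ x xs → All (_< 0ℤ) (x ∷ xs) → sum (x ∷ xs) < 0ℤ
  sum-negative x []       (x<0 ∷ [])   = subst (_< 0ℤ) (sym (+-identityʳ x)) x<0
  sum-negative x (y ∷ ys) (x<0 ∷ ys<0) = +-mono-< x<0 (sum-negative y ys ys<0)

  sum-positive : ∀ x xs → All (0ℤ <_) (x ∷ xs) → 0ℤ < sum (x ∷ xs)
  sum-positive x []       (0<x ∷ [])   = subst (0ℤ <_) (sym (+-identityʳ x)) 0<x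
  sum-positive x (y ∷ ys) (0<x ∷ 0<ys) = +-mono-< 0<x (sum-positive y ys 0<ys)

  +-cancelˡ-< : ∀ i {j k} → i + j < i + k → j < k
  +-cancelˡ-< i {j} {k} lt = subst₂ _<_ (cancel i j) (cancel i k) (+-monoʳ-< (- i) lt)
    where
    cancel : ∀ i j → - i + (i + j) ≡ j
    cancel = solve-∀

  i≡i+j⇒j≡0 : ∀ i {j} → i ≡ i + j → j ≡ 0ℤ
  i≡i+j⇒j≡0 i {j} eq = trans (cancel i j) (trans (cong (λ v → - i + v) (sym eq)) (+-inverseˡ i))
    where
    cancel : ∀ i j → j ≡ - i + (i + j)
    cancel = solve-∀

  i+j<i : ∀ i {j} → j < 0ℤ → i + j < i
  i+j<i i j<0 = subst (i + _ <_) (+-identityʳ i) (+-monoʳ-< i j<0)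

  module _ {S z T : ℤ} (S≡z+T : S ≡ z + T) where

    rest-positive : z < S → 0ℤ < T
    rest-positive z<S = +-cancelˡ-< z (subst₂ _<_ (sym (+-identityʳ z)) S≡z+T z<S)

    rest-negative : S < z → T < 0ℤ
    rest-negative S<z = +-cancelˡ-< z (subst₂ _<_ S≡z+T (sym (+-identityʳ z)) S<z)

    rest-below : 0ℤ < z → T < S
    rest-below 0<z = subst₂ _<_ (+-identityˡ T) (sym S≡z+T) (+-monoˡ-< T 0<z)

    rest-zero : z ≡ S → T ≡ 0ℤ
    rest-zero z≡S = i≡i+j⇒j≡0 z (trans z≡S S≡z+T)

  below-gap : ∀ {S y} → y ≢ 0ℤ → y ≢ S → ¬ (0ℤ < y × y < S) → ¬ (S < y) → y < 0ℤ
  below-gap {S} {y} y≢0 y≢S ¬gap ¬above with <-cmp y 0ℤ | <-cmp y S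
  ... | tri< y<0 _ _ | _            = y<0
  ... | tri≈ _ y≡0 _ | _            = ⊥-elim (y≢0 y≡0)
  ... | tri> _ _ 0<y | tri< y<S _ _ = ⊥-elim (¬gap (0<y , y<S))
  ... | tri> _ _ _   | tri≈ _ y≡S _ = ⊥-elim (y≢S y≡S)
  ... | tri> _ _ _   | tri> _ _ S<y = ⊥-elim (¬above S<y)

  above-gap : ∀ {S y} → y ≢ 0ℤ → y ≢ S → ¬ (S < y × y < 0ℤ) → ¬ (y < S) → 0ℤ < y
  above-gap {S} {y} y≢0 y≢S ¬gap ¬below with <-cmp y 0ℤ | <-cmp y S
  ... | tri> _ _ 0<y | _            = 0<y
  ... | tri≈ _ y≡0 _ | _            = ⊥-elim (y≢0 y≡0)
  ... | tri< y<0 _ _ | tri> _ _ S<y = ⊥-elim (¬gap (S<y , y<0))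
  ... | tri< _ _ _   | tri≈ _ y≡S _ = ⊥-elim (y≢S y≡S)
  ... | tri< _ _ _   | tri< y<S _ _ = ⊥-elim (¬below y<S)

  unique-chosen : ∀ {xs z rest} → xs ↭ z ∷ rest → Unique (0ℤ ∷ xs) → Unique (0ℤ ∷ z ∷ rest)
  unique-chosen xs↭ = Permutation.Unique-resp-↭ (↭⇒↭ₛ (prep 0ℤ xs↭))

  unique-rest : ∀ {xs z rest} → xs ↭ z ∷ rest → Unique (0ℤ ∷ xs) → Unique (0ℤ ∷ rest)
  unique-rest xs↭ u with (_ ∷ 0≢rest) ∷ _ ∷ urest ← unique-chosen xs↭ u = 0≢rest ∷ urest

  length-rest : ∀ {xs rest : List ℤ} {z k} → xs ↭ z ∷ rest → length xs ≡ suc k →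
                length rest ≡ k
  length-rest xs↭ len = ℕ.suc-injective (trans (sym (↭-length xs↭)) len)

  record Sequencing (c : ℤ) (Bound : ℤ → Set) (xs : List ℤ) : Set where
    field
      order    : List ℤ
      order↭xs : order ↭ xs
      distinct : Unique (sumsFrom c order)
      bounded  : All Bound (sumsFrom c order)
  open Sequencing

  Sequencing-resp-↭ : ∀ {c B xs ys} → xs ↭ ys → Sequencing c B xs → Sequencing c B ys
  Sequencing-resp-↭ xs↭ys q = record
    { order    = order q
    ; order↭xs = ↭-trans (order↭xs q) xs↭ys
    ; distinct = distinct q
    ; bounded  = bounded q
    }

  empty : ∀ {c B} → Sequencing c B []
  empty = record { order = [] ; order↭xs = ↭-refl ; distinct = [] ; bounded = [] }

  singleton : ∀ {c z B} → B (c + z) → Sequencing c B (z ∷ [])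
  singleton b = record { order = _ ∷ [] ; order↭xs = ↭-refl ; distinct = [] ∷ [] ; bounded = b ∷ [] }

  prepend : ∀ {c x rest B B′} → Sequencing (c + x) B rest →
            (∀ {u} → B u → u ≢ c + x) → (∀ {u} → B u → B′ u) → B′ (c + x) →
            Sequencing c B′ (x ∷ rest)
  prepend {x = x} q avoids weaken first = record
    { order    = x ∷ order q
    ; order↭xs = prep x (order↭xs q)
    ; distinct = All.map (λ b → avoids b ∘ sym) (bounded q) ∷ distinct q
    ; bounded  = first ∷ All.map weaken (bounded q)
    }

  append : ∀ {c z rest B B′} → Sequencing c B rest →
           (∀ {u} → B u → u ≢ c + sum (z ∷ rest)) → (∀ {u} → B u → B′ u) →
           B′ (c + sum (z ∷ rest)) → Sequencing c B′ (z ∷ rest)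
  append {c} {z} {rest} q avoids weaken last = record
    { order    = order q ++ [ z ]
    ; order↭xs = ↭-trans (↭-sym (∷↭∷ʳ z (order q))) (prep z (order↭xs q))
    ; distinct = subst Unique (sym sums≡)
        (AllPairs.++⁺ (distinct q) ([] ∷ []) (All.map (λ b → avoids b ∷ []) (bounded q)))
    ; bounded  = subst (All _) (sym sums≡) (All-++⁺ (All.map weaken (bounded q)) (last ∷ []))
    }
    where
    swap : ∀ a b d → a + b + d ≡ a + (d + b)
    swap = solve-∀
    sums≡ : sumsFrom c (order q ++ [ z ]) ≡ sumsFrom c (order q) ++ [ c + sum (z ∷ rest) ]
    sums≡ = trans (sumsFrom-∷ʳ c (order q) z)
                  (cong (λ s → sumsFrom c (order q) ++ [ s ])
                        (trans (cong (λ s → c + s + z) (sum-↭ (order↭xs q))) (swap c (sum rest) z)))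

  -- The second conjunct keeps the start c unvisited unless the total is 0, so that such a
  -- sequencing can follow a first element (in sequence⁻).
  UpTo : ℤ → ℤ → ℤ → Set
  UpTo c s u = u ≤ s × (u ≡ c → u ≡ s)

  gapless⁺ : ∀ {xs c} → Unique (0ℤ ∷ xs) → 0ℤ ≤ sum xs →
             All (λ y → ¬ (0ℤ < y × y < sum xs)) xs → All (λ y → ¬ (sum xs < y)) xs →
             Sequencing c (UpTo c (c + sum xs)) xs
  gapless⁺ {[]}          _ _ _ _ = empty
  gapless⁺ {xs@(_ ∷ _)} {c} u@(0≢xs ∷ _) 0≤S ¬gap ¬above with select (0ℤ <?_) xs
  ... | inj₁ ¬pos = ⊥-elim (<⇒≱ (sum-negative _ _ negative) 0≤S)
    where
    negative : All (_< 0ℤ) xs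
    negative = All.tabulate λ v∈ → ≤∧≢⇒< (≮⇒≥ (All.lookup ¬pos v∈)) (≢-sym (All.lookup 0≢xs v∈))
  ... | inj₂ (z , [] , _ , xs↭) =
    Sequencing-resp-↭ (↭-sym xs↭) (singleton (≤-reflexive z≡S , λ _ → z≡S))
    where
    z≡S : c + z ≡ c + sum xs
    z≡S = cong (_+_ c) (sym (trans (sum-↭ xs↭) (+-identityʳ z)))
  ... | inj₂ (z , y ∷ ys , 0<z , xs↭) =
    ⊥-elim (<⇒≢ (sum-negative y ys negative) (rest-zero (sum-↭ xs↭) z≡S))
    where
    ∈xs : ∀ {v} → v ∈ z ∷ y ∷ ys → v ∈ xs
    ∈xs = ∈-resp-↭ (↭-sym xs↭)
    z≡S : z ≡ sum xs
    z≡S with <-cmp z (sum xs)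
    ... | tri< z<S _ _ = ⊥-elim (All.lookup ¬gap (∈xs (here refl)) (0<z , z<S))
    ... | tri≈ _ z≡S _ = z≡S
    ... | tri> _ _ S<z = ⊥-elim (All.lookup ¬above (∈xs (here refl)) S<z)
    negative : All (_< 0ℤ) (y ∷ ys)
    negative with (_ ∷ 0≢rest) ∷ z≢rest ∷ _ ← unique-chosen xs↭ u = All.tabulate λ v∈ →
      below-gap (≢-sym (All.lookup 0≢rest v∈))
                (λ v≡S → All.lookup z≢rest v∈ (trans z≡S (sym v≡S)))
                (All.lookup ¬gap (∈xs (there v∈))) (All.lookup ¬above (∈xs (there v∈)))

  gapless⁻ : ∀ {xs c} → Unique (0ℤ ∷ xs) → sum xs < 0ℤ →
             All (λ y → ¬ (sum xs < y × y < 0ℤ)) xs → All (λ y → ¬ (y < sum xs)) xs →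
             Sequencing c (_< c) xs
  gapless⁻ {[]}          _ _ _ _ = empty
  gapless⁻ {xs@(_ ∷ _)} {c} u@(0≢xs ∷ _) S<0 ¬gap ¬below with select (_<? 0ℤ) xs
  ... | inj₁ ¬neg = ⊥-elim (<-asym (sum-positive _ _ positive) S<0)
    where
    positive : All (0ℤ <_) xs
    positive = All.tabulate λ v∈ → ≤∧≢⇒< (≮⇒≥ (All.lookup ¬neg v∈)) (All.lookup 0≢xs v∈)
  ... | inj₂ (z , [] , z<0 , xs↭) = Sequencing-resp-↭ (↭-sym xs↭) (singleton (i+j<i c z<0))
  ... | inj₂ (z , y ∷ ys , z<0 , xs↭) =
    ⊥-elim (<⇒≢ (sum-positive y ys positive) (sym (rest-zero (sum-↭ xs↭) z≡S)))
    where
    ∈xs : ∀ {v} → v ∈ z ∷ y ∷ ys → v ∈ xs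
    ∈xs = ∈-resp-↭ (↭-sym xs↭)
    z≡S : z ≡ sum xs
    z≡S with <-cmp z (sum xs)
    ... | tri< z<S _ _ = ⊥-elim (All.lookup ¬below (∈xs (here refl)) z<S)
    ... | tri≈ _ z≡S _ = z≡S
    ... | tri> _ _ S<z = ⊥-elim (All.lookup ¬gap (∈xs (here refl)) (S<z , z<0))
    positive : All (0ℤ <_) (y ∷ ys)
    positive with (_ ∷ 0≢rest) ∷ z≢rest ∷ _ ← unique-chosen xs↭ u = All.tabulate λ v∈ →
      above-gap (≢-sym (All.lookup 0≢rest v∈))
                (λ v≡S → All.lookup z≢rest v∈ (trans z≡S (sym v≡S)))
                (All.lookup ¬gap (∈xs (there v∈))) (All.lookup ¬below (∈xs (there v∈)))

  -- A nonnegative total S is reached last: an element z with 0 < z < S (the rest has positive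
  -- total) or z > S (negative total) is put at the end, and otherwise xs = [ S ].  Dually, a
  -- negative total is handled by putting an element first.
  mutual
    sequence⁺ : ∀ k xs c → length xs ≡ k → Unique (0ℤ ∷ xs) → 0ℤ ≤ sum xs →
                Sequencing c (UpTo c (c + sum xs)) xs
    sequence⁺ zero    []         c _   _ _   = empty
    sequence⁺ (suc k) xs@(_ ∷ _) c len u 0≤S
      with select (λ y → (0ℤ <? y) ×-dec (y <? sum xs)) xs
    ... | inj₂ (z , rest , (0<z , z<S) , xs↭) =
      Sequencing-resp-↭ (↭-sym xs↭) (append q avoids weaken (≤-reflexive S′≡S , λ _ → S′≡S))
      where
      S≡ = sum-↭ xs↭
      S′≡S = cong (_+_ c) (sym S≡)
      0<T = rest-positive S≡ z<S
      T<S = rest-below S≡ 0<z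
      q = sequence⁺ k rest c (length-rest xs↭ len) (unique-rest xs↭ u) (<⇒≤ 0<T)
      avoids : ∀ {u} → UpTo c (c + sum rest) u → u ≢ c + sum (z ∷ rest)
      avoids (u≤ , _) =
        <⇒≢ (≤-<-trans u≤ (subst (c + sum rest <_) (sym S′≡S) (+-monoʳ-< c T<S)))
      weaken : ∀ {u} → UpTo c (c + sum rest) u → UpTo c (c + sum xs) u
      weaken (u≤ , back) = ≤-trans u≤ (+-monoʳ-≤ c (<⇒≤ T<S)) ,
        λ u≡c → ⊥-elim (<⇒≢ 0<T (sym (i≡i+j⇒j≡0 c (trans (sym u≡c) (back u≡c)))))
    ... | inj₁ ¬gap with select (sum xs <?_) xs
    ...   | inj₂ (z , rest , S<z , xs↭) =
      Sequencing-resp-↭ (↭-sym xs↭) (append q avoids weaken (≤-reflexive S′≡S , λ _ → S′≡S))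
      where
      S≡ = sum-↭ xs↭
      S′≡S = cong (_+_ c) (sym S≡)
      c≤S′ : c ≤ c + sum xs
      c≤S′ = subst (_≤ c + sum xs) (+-identityʳ c) (+-monoʳ-≤ c 0≤S)
      q = sequence⁻ k rest c (length-rest xs↭ len) (unique-rest xs↭ u) (rest-negative S≡ S<z)
      avoids : ∀ {u} → u < c → u ≢ c + sum (z ∷ rest)
      avoids u<c = <⇒≢ (<-≤-trans u<c (subst (c ≤_) (sym S′≡S) c≤S′))
      weaken : ∀ {u} → u < c → UpTo c (c + sum xs) u
      weaken u<c = ≤-trans (<⇒≤ u<c) c≤S′ , λ u≡c → ⊥-elim (<⇒≢ u<c u≡c)
    ...   | inj₁ ¬above = gapless⁺ u 0≤S ¬gap ¬above

    sequence⁻ : ∀ k xs c → length xs ≡ k → Unique (0ℤ ∷ xs) → sum xs < 0ℤ →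
                Sequencing c (_< c) xs
    sequence⁻ zero    []         c _   _ _   = empty
    sequence⁻ (suc k) xs@(_ ∷ _) c len u S<0
      with select (λ y → (sum xs <? y) ×-dec (y <? 0ℤ)) xs
    ... | inj₂ (x , rest , (S<x , x<0) , xs↭) =
      Sequencing-resp-↭ (↭-sym xs↭) (prepend q <⇒≢ (λ u< → <-trans u< cx<c) cx<c)
      where
      cx<c = i+j<i c x<0
      q = sequence⁻ k rest (c + x) (length-rest xs↭ len) (unique-rest xs↭ u)
                    (rest-negative (sum-↭ xs↭) S<x)
    ... | inj₁ ¬gap with select (_<? sum xs) xs
    ...   | inj₂ (x , rest , x<S , xs↭) =
      Sequencing-resp-↭ (↭-sym xs↭) (prepend q avoids weaken (i+j<i c (<-trans x<S S<0)))
      where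
      S≡ = sum-↭ xs↭
      0<T = rest-positive S≡ x<S
      q = sequence⁺ k rest (c + x) (length-rest xs↭ len) (unique-rest xs↭ u) (<⇒≤ 0<T)
      avoids : ∀ {u} → UpTo (c + x) (c + x + sum rest) u → u ≢ c + x
      avoids (_ , back) u≡cx =
        <⇒≢ 0<T (sym (i≡i+j⇒j≡0 (c + x) (trans (sym u≡cx) (back u≡cx))))
      weaken : ∀ {u} → UpTo (c + x) (c + x + sum rest) u → u < c
      weaken (u≤ , _) = ≤-<-trans u≤
        (subst (_< c) (trans (cong (_+_ c) S≡) (sym (+-assoc c x (sum rest)))) (i+j<i c S<0))
    ...   | inj₁ ¬below = gapless⁻ u S<0 ¬gap ¬below

  -- Unique (0ℤ ∷ xs) says that the elements of xs are distinct and nonzero.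
  sequencing : ∀ xs → Unique (0ℤ ∷ xs) → ∃ λ ys → ys ↭ xs × Unique (sumsFrom 0ℤ ys)
  sequencing xs u with 0ℤ ≤? sum xs
  ... | yes 0≤S = let q = sequence⁺ (length xs) xs 0ℤ refl u 0≤S
                  in  order q , order↭xs q , distinct q
  ... | no  S≱0 = let q = sequence⁻ (length xs) xs 0ℤ refl u (≰⇒> S≱0)
                  in  order q , order↭xs q , distinct q

open IntegerSequencing using (sumsFrom; sequencing)

-- Imported only here: IntegerSequencing uses the integer order under the same names.
open import Data.Nat using (_≤_; _<_)

module Congruence where

  open import Data.Nat.Divisibility using (>⇒∤)
  open import Data.Integer.Properties using (∣i∣≡0⇒i≡0; i-j≡0⇒i≡j; +-inverseʳ; *-zeroˡ)
  open import Data.Integer.DivMod using (_%ℕ_; _/ℕ_; a≡a%ℕn+[a/ℕn]*n)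
  open import Data.Integer.Divisibility.Signed
    using (divides; ∣m∣n⇒∣m+n; ∣m⇒∣-m; ∣n⇒∣m*n; ∣⇒∣ᵤ; ∣ᵤ⇒∣) renaming (_∣_ to _∣ℤ_)
  open import Data.Integer.Coprimality using (coprime-divisor)

  infix 4 _≡[_]_
  record _≡[_]_ (i : ℤ) (n : ℕ) (j : ℤ) : Set where
    constructor congruent
    field divides-difference : + n ∣ℤ i - j

  module _ {n : ℕ} where

    ≡⇒≡-mod : ∀ {i j} → i ≡ j → i ≡[ n ] j
    ≡⇒≡-mod {i} refl = congruent (divides 0ℤ (trans (+-inverseʳ i) (sym (*-zeroˡ (+ n)))))

    ≡-mod-sym : ∀ {i j} → i ≡[ n ] j → j ≡[ n ] i
    ≡-mod-sym {i} {j} (congruent n∣i-j) =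
      congruent (subst (+ n ∣ℤ_) (negate i j) (∣m⇒∣-m n∣i-j))
      where
      negate : ∀ i j → - (i - j) ≡ j - i
      negate = solve-∀

    ≡-mod-trans : ∀ {i j k} → i ≡[ n ] j → j ≡[ n ] k → i ≡[ n ] k
    ≡-mod-trans {i} {j} {k} (congruent n∣i-j) (congruent n∣j-k) =
      congruent (subst (+ n ∣ℤ_) (telescope i j k) (∣m∣n⇒∣m+n n∣i-j n∣j-k))
      where
      telescope : ∀ i j k → i - j + (j - k) ≡ i - k
      telescope = solve-∀

    +-cong-mod : ∀ {i j k l} → i ≡[ n ] j → k ≡[ n ] l → i + k ≡[ n ] j + l
    +-cong-mod {i} {j} {k} {l} (congruent n∣i-j) (congruent n∣k-l) =
      congruent (subst (+ n ∣ℤ_) (regroup i j k l) (∣m∣n⇒∣m+n n∣i-j n∣k-l))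
      where
      regroup : ∀ i j k l → i - j + (k - l) ≡ i + k - (j + l)
      regroup = solve-∀

    -‿cong-mod : ∀ {i j k l} → i ≡[ n ] j → k ≡[ n ] l → i - k ≡[ n ] j - l
    -‿cong-mod {i} {j} {k} {l} (congruent n∣i-j) (congruent n∣k-l) =
      congruent (subst (+ n ∣ℤ_) (regroup i j k l) (∣m∣n⇒∣m+n n∣i-j (∣m⇒∣-m n∣k-l)))
      where
      regroup : ∀ i j k l → i - j + - (k - l) ≡ i - k - (j - l)
      regroup = solve-∀

    *-congˡ-mod : ∀ c {i j} → i ≡[ n ] j → c * i ≡[ n ] c * j
    *-congˡ-mod c {i} {j} (congruent n∣i-j) =
      congruent (subst (+ n ∣ℤ_) (distrib c i j) (∣n⇒∣m*n c n∣i-j))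
      where
      distrib : ∀ c i j → c * (i - j) ≡ c * i - c * j
      distrib = solve-∀

    *-cancelˡ-mod : ∀ {t i j} → Coprime n t → + t * i ≡[ n ] + t * j → i ≡[ n ] j
    *-cancelˡ-mod {t} {i} {j} coprime (congruent n∣ti-tj) = congruent (∣ᵤ⇒∣
      (coprime-divisor (+ n) (+ t) (i - j) coprime (∣⇒∣ᵤ (subst (+ n ∣ℤ_) (factor (+ t) i j) n∣ti-tj))))
      where
      factor : ∀ c i j → c * i - c * j ≡ c * (i - j)
      factor = solve-∀

    ≡-mod⇒≡ : ∀ {i j} → i ≡[ n ] j → ∣ i - j ∣ < n → i ≡ j
    ≡-mod⇒≡ {i} {j} (congruent n∣i-j) small with ∣ i - j ∣ in eq
    ... | zero  = i-j≡0⇒i≡j i j (∣i∣≡0⇒i≡0 eq)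
    ... | suc _ = ⊥-elim (>⇒∤ small (subst (n ∣_) eq (∣⇒∣ᵤ n∣i-j)))

  %ℕ-mod : ∀ i n .{{_ : NonZero n}} → + (i %ℕ n) ≡[ n ] i
  %ℕ-mod i n = ≡-mod-sym (congruent (divides (i /ℕ n) (subtract (a≡a%ℕn+[a/ℕn]*n i n))))
    where
    cancel : ∀ r q → r + q - r ≡ q
    cancel = solve-∀
    subtract : ∀ {i r q} → i ≡ r + q → i - r ≡ q
    subtract {r = r} {q} refl = cancel r q

open Congruence

∣m-n∣<o : ∀ {m n o} → m < o → n < o → ℕ.∣ m - n ∣ < o
∣m-n∣<o {m} {n} m<o n<o = ℕ.≤-<-trans (ℕ.∣m-n∣≤m⊔n m n) (ℕ.⊔-lub m<o n<o)

∣+m-+n∣≡∣m-n∣ : ∀ m n → ∣ + m - + n ∣ ≡ ℕ.∣ m - n ∣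
∣+m-+n∣≡∣m-n∣ m n with ℕ.≤-total m n
... | inj₁ m≤n = begin
  ∣ + m - + n ∣   ≡⟨ cong ∣_∣ (ℤP.m-n≡m⊖n m n) ⟩
  ∣ m ⊖ n ∣     ≡⟨ ℤP.∣⊖∣-≤ m≤n ⟩
  n ∸ m           ≡⟨ ℕ.m≤n⇒∣m-n∣≡n∸m m≤n ⟨
  ℕ.∣ m - n ∣     ∎
  where open ≡-Reasoning
... | inj₂ n≤m = begin
  ∣ + m - + n ∣   ≡⟨ cong ∣_∣ (ℤP.m-n≡m⊖n m n) ⟩
  ∣ m ⊖ n ∣     ≡⟨ ℤP.∣m⊖n∣≡∣n⊖m∣ m n ⟩
  ∣ n ⊖ m ∣     ≡⟨ ℤP.∣⊖∣-≤ n≤m ⟩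
  m ∸ n           ≡⟨ ℕ.m≤n⇒∣n-m∣≡n∸m n≤m ⟨
  ℕ.∣ m - n ∣     ∎
  where open ≡-Reasoning

/-≡⇒∣-∣< : ∀ x y n .{{_ : NonZero n}} → x / n ≡ y / n → ℕ.∣ x - y ∣ < n
/-≡⇒∣-∣< x y n x/n≡y/n = subst (_< n) (sym same-quotient) (∣m-n∣<o (m%n<n x n) (m%n<n y n))
  where
  split : ∀ m → m ≡ m / n ℕ.* n ℕ.+ m % n
  split m = trans (m≡m%n+[m/n]*n m n) (ℕ.+-comm (m % n) _)
  same-quotient : ℕ.∣ x - y ∣ ≡ ℕ.∣ x % n - y % n ∣
  same-quotient = begin
    ℕ.∣ x - y ∣
      ≡⟨ cong₂ ℕ.∣_-_∣ (split x) (split y) ⟩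
    ℕ.∣ x / n ℕ.* n ℕ.+ x % n - y / n ℕ.* n ℕ.+ y % n ∣
      ≡⟨ cong (λ q → ℕ.∣ q ℕ.* n ℕ.+ x % n - y / n ℕ.* n ℕ.+ y % n ∣) x/n≡y/n ⟩
    ℕ.∣ y / n ℕ.* n ℕ.+ x % n - y / n ℕ.* n ℕ.+ y % n ∣
      ≡⟨ ℕ.∣m+n-m+o∣≡∣n-o∣ (y / n ℕ.* n) _ _ ⟩
    ℕ.∣ x % n - y % n ∣
      ∎
    where open ≡-Reasoning

toℕ-0-mod : ∀ {n} .{{_ : NonZero n}} → toℕ (0 mod n) ≡ 0
toℕ-0-mod {n} = trans (toℕ-fromℕ< _) (m<n⇒m%n≡m (ℕ.>-nonZero⁻¹ n))

Unique-reflect : ∀ {A B : Set} {R : A → B → Set} → (∀ {x x′ y} → R x y → R x′ y → x ≡ x′) →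
                 ∀ {xs ys} → Pointwise R xs ys → Unique xs → Unique ys
Unique-reflect {R = R} R-functional = go
  where
  fresh : ∀ {x y xs ys} → R x y → Pointwise R xs ys → All (x ≢_) xs → All (y ≢_) ys
  fresh r []        []            = []
  fresh r (r′ ∷ rs) (x≢x′ ∷ x≢xs) =
    (λ y≡y′ → x≢x′ (R-functional r (subst (R _) (sym y≡y′) r′))) ∷ fresh r rs x≢xs
  go : ∀ {xs ys} → Pointwise R xs ys → Unique xs → Unique ys
  go []       []          = []
  go (r ∷ rs) (x≢xs ∷ ux) = fresh r rs x≢xs ∷ go rs ux

module Transfer {n : ℕ} .{{_ : NonZero n}} (t : ℕ) (w : Fin n → ℤ)
                (w≡ : ∀ a → w a ≡[ n ] + t * + toℕ a) where

  lift-step : ∀ {c s} a → c ≡[ n ] + t * + toℕ s → c + w a ≡[ n ] + t * + toℕ (s +ₙ a)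
  lift-step {c} {s} a c≡ts =
    ≡-mod-trans (+-cong-mod c≡ts (w≡ a)) (≡-mod-trans (≡⇒≡-mod distrib) reduce)
    where
    m = toℕ s ℕ.+ toℕ a
    distrib : + t * + toℕ s + + t * + toℕ a ≡ + t * + m
    distrib = sym (ℤP.*-distribˡ-+ (+ t) (+ toℕ s) (+ toℕ a))
    reduce : + t * + m ≡[ n ] + t * + toℕ (s +ₙ a)
    reduce = *-congˡ-mod (+ t)
      (≡-mod-sym (subst (λ r → + r ≡[ n ] + m) (sym (toℕ-fromℕ< _)) (%ℕ-mod (+ m) n)))

  module _ (D k : ℕ) where

    SmallLift : ℤ → Fin n → Set
    SmallLift p s = p ≡[ n ] + t * + toℕ s × D ℕ.* ∣ p ∣ ≤ k ℕ.* n

    smallLift-pointwise : ∀ {c s} as → c ≡[ n ] + t * + toℕ s →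
                          D ℕ.* ∣ c ∣ ℕ.+ length as ℕ.* n ≤ k ℕ.* n →
                          All (λ a → D ℕ.* ∣ w a ∣ ≤ n) as →
                          Pointwise SmallLift (sumsFrom c (map w as)) (partialSumsFrom s as)
    smallLift-pointwise []           _    _     []           = []
    smallLift-pointwise {c} (a ∷ as) c≡ts bound (wa≤ ∷ was≤) =
      (lift-step a c≡ts , ℕ.≤-trans (ℕ.m≤m+n _ _) bound′) ∷
      smallLift-pointwise as (lift-step a c≡ts) bound′ was≤
      where
      open ℕ.≤-Reasoning
      bound′ : D ℕ.* ∣ c + w a ∣ ℕ.+ length as ℕ.* n ≤ k ℕ.* n
      bound′ = begin
        D ℕ.* ∣ c + w a ∣ ℕ.+ length as ℕ.* n
          ≤⟨ ℕ.+-monoˡ-≤ _ (ℕ.*-monoʳ-≤ D (ℤP.∣i+j∣≤∣i∣+∣j∣ c (w a))) ⟩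
        D ℕ.* (∣ c ∣ ℕ.+ ∣ w a ∣) ℕ.+ length as ℕ.* n
          ≡⟨ cong (ℕ._+ length as ℕ.* n) (ℕ.*-distribˡ-+ D ∣ c ∣ ∣ w a ∣) ⟩
        D ℕ.* ∣ c ∣ ℕ.+ D ℕ.* ∣ w a ∣ ℕ.+ length as ℕ.* n
          ≤⟨ ℕ.+-monoˡ-≤ (length as ℕ.* n) (ℕ.+-monoʳ-≤ (D ℕ.* ∣ c ∣) wa≤) ⟩
        D ℕ.* ∣ c ∣ ℕ.+ n ℕ.+ length as ℕ.* n
          ≡⟨ ℕ.+-assoc (D ℕ.* ∣ c ∣) n _ ⟩
        D ℕ.* ∣ c ∣ ℕ.+ length (a ∷ as) ℕ.* n
          ≤⟨ bound ⟩
        k ℕ.* n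
          ∎

    smallLift-functional : 2 ℕ.* k < D → ∀ {p p′ s} → SmallLift p s → SmallLift p′ s → p ≡ p′
    smallLift-functional 2k<D {p} {p′} (p≡ts , p≤) (p′≡ts , p′≤) =
      ≡-mod⇒≡ (≡-mod-trans p≡ts (≡-mod-sym p′≡ts)) (ℕ.*-cancelˡ-< D _ _ (begin-strict
        D ℕ.* ∣ p - p′ ∣               ≤⟨ ℕ.*-monoʳ-≤ D (ℤP.∣i-j∣≤∣i∣+∣j∣ p p′) ⟩
        D ℕ.* (∣ p ∣ ℕ.+ ∣ p′ ∣)       ≡⟨ ℕ.*-distribˡ-+ D ∣ p ∣ ∣ p′ ∣ ⟩
        D ℕ.* ∣ p ∣ ℕ.+ D ℕ.* ∣ p′ ∣   ≤⟨ ℕ.+-mono-≤ p≤ p′≤ ⟩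
        k ℕ.* n ℕ.+ k ℕ.* n            ≡⟨ double k n ⟩
        2 ℕ.* k ℕ.* n                  <⟨ ℕ.*-monoˡ-< n 2k<D ⟩
        D ℕ.* n                        ∎))
      where
      open ℕ.≤-Reasoning
      double : ∀ k n → k ℕ.* n ℕ.+ k ℕ.* n ≡ 2 ℕ.* k ℕ.* n
      double = ℕ-solve-∀

  partialSums-unique : ∀ D (as : List (Fin n)) → 2 ℕ.* length as < D →
                       All (λ a → D ℕ.* ∣ w a ∣ ≤ n) as →
                       Unique (sumsFrom 0ℤ (map w as)) → Unique (partialSums as)
  partialSums-unique D as 2k<D small =
    Unique-reflect (smallLift-functional D k 2k<D) (smallLift-pointwise D k as start initial small)
    where
    k = length as
    start : 0ℤ ≡[ n ] + t * + toℕ (0 mod n)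
    start = ≡⇒≡-mod (sym (trans (cong (λ r → + t * + r) toℕ-0-mod) (ℤP.*-zeroʳ (+ t))))
    initial : D ℕ.* 0 ℕ.+ k ℕ.* n ≤ k ℕ.* n
    initial = ℕ.≤-reflexive (cong (ℕ._+ k ℕ.* n) (ℕ.*-zeroʳ D))

open Transfer using (partialSums-unique)

encode : ∀ {A : Set} {b} → (A → Fin b) → (xs : List A) → Fin (b ^ length xs)
encode f []       = zero
encode f (x ∷ xs) = combine (f x) (encode f xs)

encode-injective : ∀ {A : Set} {b} (f g : A → Fin b) xs → encode f xs ≡ encode g xs →
                   All (λ x → f x ≡ g x) xs
encode-injective f g []       _  = []
encode-injective f g (x ∷ xs) eq =
  let fx≡gx , encodings≡ = combine-injective (f x) (encode f xs) (g x) (encode g xs) eq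
  in  fx≡gx ∷ encode-injective f g xs encodings≡

record Approximation (D n : ℕ) (A : List (Fin n)) : Set where
  field
    t                : ℕ
    t-positive       : 0 < t
    t-bounded        : t ≤ D ^ length A
    weight           : Fin n → ℤ
    weight-congruent : ∀ a → weight a ≡[ n ] + t * + toℕ a
    weight-small     : All (λ a → D ℕ.* ∣ weight a ∣ < n) A

module _ (D : ℕ) .{{_ : NonZero D}} {n : ℕ} .{{_ : NonZero n}} where

  residue : ℕ → Fin n → ℕ
  residue s a = (s ℕ.* toℕ a) % n

  -- ⌊D · r / n⌋ for the residue r of s·a, the leading base-D digit of r / n.
  digit : ℕ → Fin n → Fin D
  digit s a = fromℕ< (m<n*o⇒m/o<n (ℕ.*-monoʳ-< D (m%n<n (s ℕ.* toℕ a) n)))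

  residue-difference : ∀ {i j} a → i ≤ j →
                       + residue j a - + residue i a ≡[ n ] + (j ∸ i) * + toℕ a
  residue-difference {i} {j} a i≤j = ≡-mod-trans
    (-‿cong-mod (%ℕ-mod (+ (j ℕ.* toℕ a)) n) (%ℕ-mod (+ (i ℕ.* toℕ a)) n))
    (≡⇒≡-mod (begin
      + (j ℕ.* toℕ a) - + (i ℕ.* toℕ a)
        ≡⟨ cong (λ m → + m - + (i ℕ.* toℕ a)) split ⟩
      + (i ℕ.* toℕ a ℕ.+ (j ∸ i) ℕ.* toℕ a) - + (i ℕ.* toℕ a)
        ≡⟨ cancel (i ℕ.* toℕ a) ((j ∸ i) ℕ.* toℕ a) ⟩
      + ((j ∸ i) ℕ.* toℕ a)
        ≡⟨ ℤP.pos-* (j ∸ i) (toℕ a) ⟩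
      + (j ∸ i) * + toℕ a
        ∎))
    where
    open ≡-Reasoning
    split : j ℕ.* toℕ a ≡ i ℕ.* toℕ a ℕ.+ (j ∸ i) ℕ.* toℕ a
    split = trans (cong (ℕ._* toℕ a) (sym (ℕ.m+[n∸m]≡n i≤j))) (ℕ.*-distribʳ-+ (toℕ a) i (j ∸ i))
    add-sub : ∀ a b → a + b - a ≡ b
    add-sub = solve-∀
    cancel : ∀ m k → + (m ℕ.+ k) - + m ≡ + k
    cancel m k = trans (cong (_- + m) (ℤP.pos-+ m k)) (add-sub (+ m) (+ k))

  same-digit⇒close : ∀ {i j} a → digit i a ≡ digit j a →
                     D ℕ.* ∣ + residue j a - + residue i a ∣ < n
  same-digit⇒close {i} {j} a same = begin-strict
    D ℕ.* ∣ + residue j a - + residue i a ∣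
      ≡⟨ cong (D ℕ.*_) (∣+m-+n∣≡∣m-n∣ (residue j a) (residue i a)) ⟩
    D ℕ.* ℕ.∣ residue j a - residue i a ∣
      ≡⟨ ℕ.*-distribˡ-∣-∣ D (residue j a) (residue i a) ⟩
    ℕ.∣ D ℕ.* residue j a - D ℕ.* residue i a ∣
      <⟨ /-≡⇒∣-∣< _ _ n quotients≡ ⟩
    n
      ∎
    where
    open ℕ.≤-Reasoning
    quotients≡ : D ℕ.* residue j a / n ≡ D ℕ.* residue i a / n
    quotients≡ = trans (sym (toℕ-fromℕ< _)) (trans (cong toℕ (sym same)) (toℕ-fromℕ< _))

  -- Two of the multipliers 0, …, D^|A| give the same digit for every a ∈ A; t is their difference.
  approximation : ∀ A → Approximation D n A
  approximation A with pigeonhole (ℕ.n<1+n (D ^ length A)) (λ s → encode (digit (toℕ s)) A)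
  ... | i , j , i<j , encodings≡ = record
    { t                = toℕ j ∸ toℕ i
    ; t-positive       = ℕ.m<n⇒0<n∸m i<j
    ; t-bounded        = ℕ.≤-trans (ℕ.m∸n≤m (toℕ j) (toℕ i)) (ℕ.≤-pred (toℕ<n j))
    ; weight           = λ a → + residue (toℕ j) a - + residue (toℕ i) a
    ; weight-congruent = λ a → residue-difference {toℕ i} {toℕ j} a (ℕ.<⇒≤ i<j)
    ; weight-small     = All.map (same-digit⇒close {toℕ i} {toℕ j} _)
                                 (encode-injective _ _ A encodings≡)
    }

coprime-to-smaller : ∀ {N n t} → AllPrimeFactorsAbove N n → 0 < t → t ≤ N → Coprime n t
coprime-to-smaller {N} {n} {t} large 0<t t≤N {d} (d∣n , d∣t) = no-prime-factor (factorise d)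
  where
  instance
    t≢0 : NonZero t
    t≢0 = ℕ.>-nonZero 0<t
    d≢0 : NonZero d
    d≢0 = ℕ.≢-nonZero λ d≡0 → ℕ.<⇒≢ 0<t (sym (0∣⇒≡0 (subst (_∣ t) d≡0 d∣t)))
  no-prime-factor : PrimeFactorisation d → d ≡ 1
  no-prime-factor record { factors = [] ; isFactorisation = d≡1 } = d≡1
  no-prime-factor record { factors = p ∷ ps ; isFactorisation = d≡p*ps ; factorsPrime = p-prime ∷ _ } =
    ⊥-elim (ℕ.<⇒≱ (large p p-prime (∣-trans p∣d d∣n)) (ℕ.≤-trans (∣⇒≤ (∣-trans p∣d d∣t)) t≤N))
    where
    p∣d : p ∣ d
    p∣d = subst (p ∣_) (sym d≡p*ps) (m∣m*n (product ps))

module Weights {n : ℕ} .{{_ : NonZero n}} {t : ℕ} (w : Fin n → ℤ)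
               (w≡ : ∀ a → w a ≡[ n ] + t * + toℕ a) (coprime : Coprime n t) where

  scaled-injective : ∀ {x y} → x < n → y < n → + t * + x ≡[ n ] + t * + y → x ≡ y
  scaled-injective {x} {y} x<n y<n tx≡ty = ℤP.+-injective (≡-mod⇒≡ (*-cancelˡ-mod coprime tx≡ty)
    (subst (_< n) (sym (∣+m-+n∣≡∣m-n∣ x y)) (∣m-n∣<o x<n y<n)))

  weight-injective : ∀ {a b} → w a ≡ w b → a ≡ b
  weight-injective {a} {b} wa≡wb = toℕ-injective (scaled-injective (toℕ<n a) (toℕ<n b)
    (≡-mod-trans (≡-mod-sym (w≡ a)) (subst (_≡[ n ] _) (sym wa≡wb) (w≡ b))))

  weight-nonzero : ∀ {a} → a ≢ 0 mod n → w a ≢ 0ℤ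
  weight-nonzero {a} a≢0 wa≡0 =
    a≢0 (toℕ-injective (trans (scaled-injective (toℕ<n a) (ℕ.>-nonZero⁻¹ n) ta≡t0) (sym toℕ-0-mod)))
    where
    ta≡t0 : + t * + toℕ a ≡[ n ] + t * + 0
    ta≡t0 = ≡-mod-trans (≡-mod-sym (w≡ a)) (≡⇒≡-mod (trans wa≡0 (sym (ℤP.*-zeroʳ (+ t)))))

  weights-distinct : ∀ {A} → Unique A → All (_≢ 0 mod n) A → Unique (0ℤ ∷ map w A)
  weights-distinct uA nzA =
    All-map⁺ (All.map (≢-sym ∘ weight-nonzero) nzA) ∷ Unique-map⁺ weight-injective uA

sequenceable : ∀ k (n : ℕ) .{{_ : NonZero n}} → AllPrimeFactorsAbove (suc (2 ℕ.* k) ^ k) n →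
               (A : List (Fin n)) → Unique A → All (_≢ 0 mod n) A → length A ≤ k →
               ∃ λ ordering → ordering ↭ A × Unique (partialSums ordering)
sequenceable k n large A uA nzA |A|≤k = reorder (sequencing (map weight A) (weights-distinct uA nzA))
  where
  D = suc (2 ℕ.* k)
  open Approximation (approximation D A)
  open Weights weight weight-congruent
               (coprime-to-smaller large t-positive (ℕ.≤-trans t-bounded (ℕ.^-monoʳ-≤ D |A|≤k)))
  reorder : (∃ λ ys → ys ↭ map weight A × Unique (sumsFrom 0ℤ ys)) →
            ∃ λ ordering → ordering ↭ A × Unique (partialSums ordering)
  reorder (ys , ys↭ , distinct) with ordering , refl , A↭ordering ← ↭-map-inv weight (↭-sym ys↭) =
    ordering , ↭-sym A↭ordering ,
    partialSums-unique t weight weight-congruent D ordering 2|o|<D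
                       (All-resp-↭ A↭ordering (All.map ℕ.<⇒≤ weight-small)) distinct
    where
    2|o|<D : 2 ℕ.* length ordering < D
    2|o|<D = ℕ.s≤s (ℕ.*-monoʳ-≤ 2 (ℕ.≤-trans (ℕ.≤-reflexive (sym (↭-length A↭ordering))) |A|≤k))

corollary4p4 : ∃ λ (N : ℕ) → 0 < N ×
    ((n : ℕ) .{{_ : NonZero n}} → AllPrimeFactorsAbove N n →
      (A : List (Fin n)) → Unique A → All (λ a → a ≢ 0 mod n) A → length A ≤ 12 →
      Σ (List (Fin n)) λ ordering → (ordering ↭ A) × Unique (partialSums ordering))
corollary4p4 = 25 ^ 12 , ℕ.m^n>0 25 12 , sequenceable 12
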